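{- Fix gridded permutations $g$ and $h$ and a cell $c\in\mathbb{N}^2$. If $h\le g$, then every multiplex of $g$ around $c$ contains some multiplex of $h$ around $c$: for every $g'\in M_c(g)$ there exists $h'\in M_c(h)$ with $h'\le g'$.
   Context: A gridded permutation of size $n$ is a pair $(\pi,(c_1,\ldots,c_n))$ with $\pi$ a permutation of $\{1,\ldots,n\}$ and cells $c_i=(x_i,y_i)\in\mathbb{N}^2$ such that $x_i\le x_j$ whenever $i<j$ and $y_i\le y_j$ whenever $\pi(i)<\pi(j)$. Containment $h\le g$ for $g=(\pi,(c_i))$, $h=(\sigma,(d_j))$ of size $k$: there are indices $i_1<\cdots<i_k$ with $\pi(i_1)\cdots\pi(i_k)$ order-isomorphic to $\sigma$ and $c_{i_j}=d_j$ for all $j$. For $p\in\mathbb{N}$ let $b_p(i)=i$ if $i<p$, $b_p(i)=p$ if $i\in\{p,p+1,p+2\}$, $b_p(i)=i-2$ if $i>p+2$; for $c=(c_x,c_y)$ let $\beta_c(a,b)=(b_{c_x}(a),b_{c_y}(b))$. The set of multiplexes of $g=(\pi,(c_1,\ldots,c_n))$ around $c$ is $M_c(g)=\{(\pi,(c'_1,\ldots,c'_n)) \text{ a gridded permutation} : \beta_c(c'_i)=c_i \text{ for } 1\le i\le n\}$. -}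

module Defs where

open import Data.Nat using (ℕ; _<ᵇ_; _≤ᵇ_; _+_; _∸_) renaming (_≤_ to _≤ℕ_)
open import Data.Bool using (if_then_else_)
open import Data.Fin using (Fin; _<_)
open import Data.Fin.Permutation using (Permutation′; _⟨$⟩ʳ_)
open import Data.Product using (_×_; _,_; proj₁; proj₂; Σ; ∃)
open import Function.Bundles using (_⇔_)
open import Relation.Binary.PropositionalEquality using (_≡_)

Cell : Set
Cell = ℕ × ℕ

-- A gridded permutation of size n.  Positions/values are indexed by Fin n
-- (0-based instead of 1-based; this is only a relabelling).
record GP (n : ℕ) : Set where
  field
    perm : Permutation′ n
    cell : Fin n → Cell
    colOK : ∀ i j → i < j → proj₁ (cell i) ≤ℕ proj₁ (cell j)
    rowOK : ∀ i j → (perm ⟨$⟩ʳ i) < (perm ⟨$⟩ʳ j) → proj₂ (cell i) ≤ℕ proj₂ (cell j)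
open GP public

_≼_ : ∀ {k n} → GP k → GP n → Set
_≼_ {k} {n} h g =
  Σ (Fin k → Fin n) λ e →
    (∀ i j → i < j → e i < e j)
    × (∀ i j → ((perm h ⟨$⟩ʳ i) < (perm h ⟨$⟩ʳ j)) ⇔ ((perm g ⟨$⟩ʳ e i) < (perm g ⟨$⟩ʳ e j)))
    × (∀ j → cell g (e j) ≡ cell h j)

b : ℕ → ℕ → ℕ
b p i = if i <ᵇ p then i else (if i ≤ᵇ p + 2 then p else i ∸ 2)

β : Cell → Cell → Cell
β (cx , cy) (a , a') = (b cx a , b cy a')

-- g' ∈ M_c(g): same permutation, and β_c maps each new cell to the old one.
-- (g' being a gridded permutation is built into the type GP n.)
Multiplex : ∀ {n} → Cell → GP n → GP n → Set
Multiplex c g g' =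
  (∀ i → perm g' ⟨$⟩ʳ i ≡ perm g ⟨$⟩ʳ i) × (∀ i → β c (cell g' i) ≡ cell g i)

{-# OPTIONS --safe #-}
module Submission where

open import Defs
open import Data.Product using (Σ; _×_; _,_)
open import Data.Fin using (Fin; _<_)
open import Data.Fin.Permutation using (Permutation′; _⟨$⟩ʳ_)
open import Function.Bundles using (_⇔_; Equivalence)
import Function.Properties.Equivalence as ⇔
open import Relation.Binary.PropositionalEquality using (_≡_; refl; trans)

-- The multiplex of h is obtained by pulling the cells of g' back along the
-- embedding witnessing h ≼ g: a multiplex only refines cells, and keeps the
-- permutation, so the embedding still matches the pattern of h inside g'.

samePerm⇒<-⇔ : ∀ {n} {p q : Permutation′ n} → (∀ i → p ⟨$⟩ʳ i ≡ q ⟨$⟩ʳ i) →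
  ∀ i j → (p ⟨$⟩ʳ i < p ⟨$⟩ʳ j) ⇔ (q ⟨$⟩ʳ i < q ⟨$⟩ʳ j)
samePerm⇒<-⇔ p≗q i j rewrite p≗q i | p≗q j = ⇔.refl

module _ {k n} (g : GP n) (σ : Permutation′ k) (e : Fin k → Fin n)
         (e-mono : ∀ i j → i < j → e i < e j)
         (e-iso : ∀ i j → (σ ⟨$⟩ʳ i < σ ⟨$⟩ʳ j) ⇔ (perm g ⟨$⟩ʳ e i < perm g ⟨$⟩ʳ e j))
         where

  pullback : GP k
  pullback = record
    { perm  = σ
    ; cell  = λ i → cell g (e i)
    ; colOK = λ i j i<j → colOK g (e i) (e j) (e-mono i j i<j)
    ; rowOK = λ i j σi<σj → rowOK g (e i) (e j) (Equivalence.to (e-iso i j) σi<σj)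
    }

  pullback-≼ : pullback ≼ g
  pullback-≼ = e , e-mono , e-iso , λ _ → refl

lemma6p5 : ∀ {n k} (g : GP n) (h : GP k) (c : Cell) → h ≼ g →
    ∀ (g' : GP n) → Multiplex c g g' → Σ (GP k) (λ h' → Multiplex c h h' × (h' ≼ g'))
lemma6p5 g h c (e , e-mono , e-iso , e-cell) g' (g'-perm , g'-cell) =
  pullback g' (perm h) e e-mono e-iso′ ,
  ((λ _ → refl) , λ i → trans (g'-cell (e i)) (e-cell i)) ,
  pullback-≼ g' (perm h) e e-mono e-iso′
  where
  e-iso′ : ∀ i j → (perm h ⟨$⟩ʳ i < perm h ⟨$⟩ʳ j) ⇔ (perm g' ⟨$⟩ʳ e i < perm g' ⟨$⟩ʳ e j)
  e-iso′ i j = ⇔.trans (e-iso i j) (⇔.sym (samePerm⇒<-⇔ {p = perm g'} {q = perm g} g'-perm (e i) (e j)))
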